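{- Let $(V,E)$ be an interval graph and $\prec$ a strict partial order associated to $(V,E)$. Let $W=\{(a,b)\in V\times V\mid\neg\,a\,E\,b\}$, with $(a,b)\,Q\,(c,d)$ iff $a\,E\,c$ and $b\,E\,d$. If $(a,b),(c,d)\in W$ are connected by a path in the graph $(W,Q)$ and $a\prec b$, then $c\prec d$. In particular $(a,b)$ and $(b,a)$ are never connected by a path in $(W,Q)$, for $(a,b)\in W$.
   Context: A graph $(V,E)$ has $E$ symmetric. An interval graph is a reflexive graph for which there exist a linear order $L$ and an assignment of a nonempty interval $F(v)\subseteq L$ to each vertex with $v\,E\,u\iff F(v)\cap F(u)\ne\emptyset$. A strict partial order $\prec$ on $V$ is associated to $(V,E)$ if for all $u,v$: $\neg\,u\,E\,v$ iff ($u\prec v$ or $v\prec u$). -}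

module Defs where

open import Level using (0ℓ)
open import Data.Product using (Σ; ∃; _×_; _,_; proj₁; proj₂)
open import Data.Sum using (_⊎_)
open import Relation.Nullary using (¬_)
open import Relation.Binary.Core using (Rel)
open import Relation.Binary.Definitions using (Symmetric; Reflexive)
open import Relation.Binary.PropositionalEquality using (_≡_)
open import Relation.Binary.Structures using (IsStrictPartialOrder)
open import Relation.Binary.Bundles using (TotalOrder)
open import Relation.Binary.Construct.Closure.ReflexiveTransitive using (Star)

record IsGraph {V : Set} (E : Rel V 0ℓ) : Set where
  field
    sym : Symmetric E

record IsInterval (L : TotalOrder 0ℓ 0ℓ 0ℓ) (I : TotalOrder.Carrier L → Set) : Set where
  open TotalOrder L
  field
    nonempty : ∃ λ x → I x
    convex   : ∀ {x y z} → I x → I z → x ≤ y → y ≤ z → I y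

record IsIntervalGraph {V : Set} (E : Rel V 0ℓ) : Set₁ where
  field
    isGraph : IsGraph E
    refl    : Reflexive E
    L       : TotalOrder 0ℓ 0ℓ 0ℓ
    F       : V → TotalOrder.Carrier L → Set
    F-int   : ∀ v → IsInterval L (F v)
    F-rep₁  : ∀ {u v} → E v u → ∃ λ x → F v x × F u x
    F-rep₂  : ∀ {u v} → (∃ λ x → F v x × F u x) → E v u

record IsAssociated {V : Set} (E : Rel V 0ℓ) (_≺_ : Rel V 0ℓ) : Set where
  field
    isSPO : IsStrictPartialOrder _≡_ _≺_
    assoc₁ : ∀ {u v} → ¬ E u v → (u ≺ v) ⊎ (v ≺ u)
    assoc₂ : ∀ {u v} → (u ≺ v) ⊎ (v ≺ u) → ¬ E u v

W : {V : Set} → Rel V 0ℓ → Set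
W {V} E = Σ (V × V) λ p → ¬ E (proj₁ p) (proj₂ p)

Q : {V : Set} (E : Rel V 0ℓ) → Rel (W E) 0ℓ
Q E ((a , b) , _) ((c , d) , _) = E a c × E b d

Connected : {V : Set} (E : Rel V 0ℓ) → Rel (W E) 0ℓ
Connected E = Star (Q E)

{-# OPTIONS --safe #-}
-- Along a Q-edge (a,b) — (c,d) with a ≺ b, the reverse orientation d ≺ c would
-- force a E d and c E b, so a – c – b – d – a would be a 4-cycle with
-- non-adjacent opposite vertices; interval graphs have no such induced C₄,
-- because two intervals meeting both of two disjoint intervals meet each other.
module Submission where

open import Defs
open import Level using (0ℓ)
open import Data.Product using (∃; _×_; _,_; swap; map₂)
open import Data.Sum using (inj₁; inj₂)
open import Data.Empty using (⊥-elim)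
open import Function using (_∘_; id)
open import Relation.Nullary using (¬_)
open import Relation.Binary.Core using (Rel)
open import Relation.Binary.Bundles using (TotalOrder)
open import Relation.Binary.Structures using (IsStrictPartialOrder)
open import Relation.Binary.Construct.Closure.ReflexiveTransitive using (fold; reverse)

module Intervals (L : TotalOrder 0ℓ 0ℓ 0ℓ) where
  open TotalOrder L
  open IsInterval

  Meet : (I J : Carrier → Set) → Set
  Meet I J = ∃ λ p → I p × J p

  module _ {C D : Carrier → Set} (iC : IsInterval L C) (iD : IsInterval L D)
           (C∩D=∅ : ¬ Meet C D) where

    disjoint-separated : ∀ {c d} → C c → D d → c ≤ d →
                         ∀ {c′ d′} → C c′ → D d′ → c′ ≤ d′
    disjoint-separated {c} {d} c∈C d∈D c≤d {c′} {d′} c′∈C d′∈D with total c′ d′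
    ... | inj₁ c′≤d′ = c′≤d′
    ... | inj₂ d′≤c′ with total c d′
    ...   | inj₁ c≤d′ = ⊥-elim (C∩D=∅ (d′ , convex iC c∈C c′∈C c≤d′ d′≤c′ , d′∈D))
    ...   | inj₂ d′≤c = ⊥-elim (C∩D=∅ (c , c∈C , convex iD d′∈D d∈D d′≤c c≤d))

  module _ {A B C D : Carrier → Set} (iA : IsInterval L A) (iB : IsInterval L B)
           (C≤D : ∀ {c d} → C c → D d → c ≤ d) where

    meet-across-separated : ∀ {x w y z} → A x → C x → A w → D w →
                            B y → C y → B z → D z → Meet A B
    meet-across-separated {x} {w} {y} {z} x∈A x∈C w∈A w∈D y∈B y∈C z∈B z∈D
      with total x y
    ... | inj₁ x≤y = y , convex iA x∈A w∈A x≤y (C≤D y∈C w∈D) , y∈B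
    ... | inj₂ y≤x = x , x∈A , convex iB y∈B z∈B y≤x (C≤D x∈C z∈D)

  meet-of-meeting-disjoint : ∀ {A B C D} → IsInterval L A → IsInterval L B →
    IsInterval L C → IsInterval L D → ¬ Meet C D →
    Meet A C → Meet A D → Meet B C → Meet B D → Meet A B
  meet-of-meeting-disjoint iA iB iC iD C∩D=∅
    (x , x∈A , x∈C) (w , w∈A , w∈D) (y , y∈B , y∈C) (z , z∈B , z∈D)
    with total y z
  ... | inj₁ y≤z = meet-across-separated iA iB
          (disjoint-separated iC iD C∩D=∅ y∈C z∈D y≤z)
          x∈A x∈C w∈A w∈D y∈B y∈C z∈B z∈D
  ... | inj₂ z≤y = meet-across-separated iA iB
          (disjoint-separated iD iC (C∩D=∅ ∘ map₂ swap) z∈D y∈C z≤y)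
          w∈A w∈D x∈A x∈C z∈B z∈D y∈B y∈C

module _ {V : Set} {E : Rel V 0ℓ} (G : IsGraph E) where
  open IsGraph G

  Connected-sym : ∀ {p q} → Connected E p q → Connected E q p
  Connected-sym = reverse λ (ac , bd) → sym ac , sym bd

module _ {V : Set} {E : Rel V 0ℓ} (IG : IsIntervalGraph E) where
  open IsIntervalGraph IG
  open Intervals L

  noInducedC₄ : ∀ {a b c d} → E a c → E a d → E b c → E b d → ¬ E c d → E a b
  noInducedC₄ {a} {b} {c} {d} ac ad bc bd ¬cd =
    F-rep₂ (meet-of-meeting-disjoint (F-int a) (F-int b) (F-int c) (F-int d)
             (¬cd ∘ F-rep₂) (F-rep₁ ac) (F-rep₁ ad) (F-rep₁ bc) (F-rep₁ bd))

module _ {V : Set} {E : Rel V 0ℓ} {_≺_ : Rel V 0ℓ}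
         (IG : IsIntervalGraph E) (AS : IsAssociated E _≺_) where
  open IsIntervalGraph IG using (isGraph)
  open IsAssociated AS
  open IsStrictPartialOrder isSPO using (trans; asym)

  ≺⇒¬E : ∀ {u v} → u ≺ v → ¬ E u v
  ≺⇒¬E = assoc₂ ∘ inj₁

  ≻⇒¬E : ∀ {u v} → v ≺ u → ¬ E u v
  ≻⇒¬E = assoc₂ ∘ inj₂

  Q-preserves-≺ : ∀ {a b c d} → E a c → E b d → ¬ E c d → a ≺ b → c ≺ d
  Q-preserves-≺ {a} {b} {c} {d} ac bd ¬cd a≺b with assoc₁ ¬cd
  ... | inj₁ c≺d = c≺d
  ... | inj₂ d≺c = ⊥-elim (¬¬ad λ ad → ¬¬cb λ cb →
                     ≺⇒¬E a≺b (noInducedC₄ IG ac ad (IsGraph.sym isGraph cb) bd ¬cd))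
    where
    ¬¬ad : ¬ ¬ E a d
    ¬¬ad ¬ad with assoc₁ ¬ad
    ... | inj₁ a≺d = ≺⇒¬E (trans a≺d d≺c) ac
    ... | inj₂ d≺a = ≻⇒¬E (trans d≺a a≺b) bd
    ¬¬cb : ¬ ¬ E c b
    ¬¬cb ¬cb with assoc₁ ¬cb
    ... | inj₁ c≺b = ≻⇒¬E (trans d≺c c≺b) bd
    ... | inj₂ b≺c = ≺⇒¬E (trans a≺b b≺c) ac

  Increasing : W E → Set
  Increasing ((a , b) , _) = a ≺ b

  Connected-preserves-≺ : ∀ {p q} → Connected E p q → Increasing p → Increasing q
  Connected-preserves-≺ =
    fold (λ p q → Increasing p → Increasing q)
         (λ { {_} {(c , d) , ¬cd} (ac , bd) rest → rest ∘ Q-preserves-≺ ac bd ¬cd })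
         id

  ¬Connected-reversed : ∀ {a b} {¬ab : ¬ E a b} {¬ba : ¬ E b a} →
                        ¬ Connected E ((a , b) , ¬ab) ((b , a) , ¬ba)
  ¬Connected-reversed {¬ab = ¬ab} path with assoc₁ ¬ab
  ... | inj₁ a≺b = asym a≺b (Connected-preserves-≺ path a≺b)
  ... | inj₂ b≺a = asym b≺a (Connected-preserves-≺ (Connected-sym isGraph path) b≺a)

proposition3p3 : {V : Set} (E : Rel V 0ℓ) (_≺_ : Rel V 0ℓ) →
    IsIntervalGraph E → IsAssociated E _≺_ →
    (∀ (a b c d : V) (nab : ¬ E a b) (ncd : ¬ E c d) →
      Connected E ((a , b) , nab) ((c , d) , ncd) → a ≺ b → c ≺ d)
    × (∀ (a b : V) (nab : ¬ E a b) (nba : ¬ E b a) →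
      ¬ Connected E ((a , b) , nab) ((b , a) , nba))
proposition3p3 E _≺_ IG AS =
  (λ _ _ _ _ _ _ → Connected-preserves-≺ IG AS) ,
  (λ _ _ _ _ → ¬Connected-reversed IG AS)
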